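{- Let $p$ be a prime power, $s\ge1$, $d\ge 3$, $R=\mathbb{F}_p[t]/\langle t^s\rangle$. For $l\in[d]$ let $K_l=\langle e_{j,j+1}(at+b) : a,b\in\mathbb{F}_p,\ j\in[d]\setminus\{l\}\rangle$ and $G=\langle K_1,\ldots,K_d\rangle$. Let $i,j\in[d]$ be distinct and not consecutive modulo $d$ (i.e. $i-j\not\equiv\pm1\pmod d$), and let $v=\{K_l : l\in[d]\setminus\{i,j\}\}$, a face of the coset complex $\mathcal{X}(G,\{K_1,\ldots,K_d\})$. Then the $1$-skeleton of the link of $v$ is a complete bipartite graph.
   Context: $R=\mathbb{F}_p[t]/\langle t^s\rangle$. $e_{i,j}(r)$ is the $d\times d$ matrix over $R$ with $1$'s on the diagonal, $r$ in entry $(i,j)$ and $0$ elsewhere; indices modulo $d$. The coset complex $\mathcal{X}(G,\{K_1,\ldots,K_d\})$ has as vertices the left cosets $gK_l$ (type $l$) and as faces the sets of cosets of pairwise distinct types with nonempty common intersection. The link of a face $v$ is $X_v=\{T\setminus v: T\in X,\ v\subseteq T\}$. -}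

module Defs where

open import Level using (Level; _⊔_)
open import Algebra.Bundles using (CommutativeRing)
open import Data.Nat as ℕ using (ℕ; zero; suc; _≤_; _^_; _≡ᵇ_)
open import Data.Nat.Primality using (Prime)
open import Data.Fin as Fin using (Fin; toℕ; fromℕ<; _≟_)
open import Data.Bool using (Bool; true; false; if_then_else_)
open import Data.Product using (Σ; ∃; ∃₂; _×_; _,_)
open import Data.List using (List; []; _∷_; map; filter; _++_; allFin)
open import Data.List.Relation.Unary.All using (All)
open import Data.List.Relation.Unary.Any using (Any)
open import Data.List.Relation.Unary.AllPairs using (AllPairs)
open import Relation.Nullary using (¬_; yes; no)
open import Relation.Nullary.Decidable using (¬?; _×-dec_)
open import Relation.Binary.PropositionalEquality using (_≡_; _≢_)
open import Function.Bundles using (_⇔_)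

record IsField {c ℓ} (F : CommutativeRing c ℓ) : Set (c ⊔ ℓ) where
  open CommutativeRing F
  field
    1≉0     : ¬ (1# ≈ 0#)
    inverse : ∀ x → ¬ (x ≈ 0#) → ∃ λ y → (x * y) ≈ 1#

record HasSize {c ℓ} (F : CommutativeRing c ℓ) (q : ℕ) : Set (c ⊔ ℓ) where
  open CommutativeRing F
  field
    enum  : Fin q → Carrier
    surj  : ∀ x → ∃ λ k → enum k ≈ x
    inj   : ∀ k k' → enum k ≈ enum k' → k ≡ k'

IsPrimePower : ℕ → Set
IsPrimePower q = ∃₂ λ r k → Prime r × 1 ≤ k × q ≡ r ^ k

nextMod : ∀ {d} → Fin d → Fin d
nextMod {suc n} j with toℕ j ℕ.<? n
... | yes p = fromℕ< (ℕ.s≤s p)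
... | no _  = Fin.zero

IsCompleteBipartite : ∀ {a b} (V : Set a) (E : V → V → Set b) → Set (a ⊔ b)
IsCompleteBipartite V E =
  Σ (V → Bool) λ side →
    (∃ λ u → side u ≡ true) × (∃ λ u → side u ≡ false) ×
    (∀ u w → E u w ⇔ (side u ≢ side w))

-- The construction, over a commutative ring F (a finite field F_p in the theorem)

module Construction {c ℓ} (F : CommutativeRing c ℓ) (s d : ℕ) where
  open CommutativeRing F

  sumFin : (n : ℕ) → (Fin n → Carrier) → Carrier
  sumFin zero    f = 0#
  sumFin (suc n) f = f Fin.zero + sumFin n (λ k → f (Fin.suc k))

  -- R = F[t]/<t^s>, elements are coefficient vectors of length s
  R : Set c
  R = Fin s → Carrier

  _≈R_ : R → R → Set ℓ
  f ≈R g = ∀ k → f k ≈ g k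

  _+R_ : R → R → R
  (f +R g) k = f k + g k

  _*R_ : R → R → R
  (f *R g) k = sumFin s λ m → sumFin s λ n →
    if (toℕ m ℕ.+ toℕ n) ≡ᵇ toℕ k then f m * g n else 0#

  0R : R
  0R k = 0#

  1R : R
  1R k with toℕ k
  ... | zero  = 1#
  ... | suc _ = 0#

  lin : Carrier → Carrier → R
  lin a b k with toℕ k
  ... | zero        = b
  ... | suc zero    = a
  ... | suc (suc _) = 0#

  Mat : Set c
  Mat = Fin d → Fin d → R

  _≈M_ : Mat → Mat → Set ℓ
  A ≈M B = ∀ i j → A i j ≈R B i j

  sumR : (n : ℕ) → (Fin n → R) → R
  sumR zero    f = 0R
  sumR (suc n) f = f Fin.zero +R sumR n (λ k → f (Fin.suc k))

  _*M_ : Mat → Mat → Mat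
  (A *M B) i k = sumR d λ j → A i j *R B j k

  1M : Mat
  1M i j with i ≟ j
  ... | yes _ = 1R
  ... | no  _ = 0R

  e : Fin d → Fin d → R → Mat
  e i j r a b with a ≟ b | a ≟ i | b ≟ j
  ... | yes _ | _     | _     = 1R
  ... | no  _ | yes _ | yes _ = r
  ... | no  _ | _     | _     = 0R

  data ⟨_⟩ {ℓ'} (S : Mat → Set ℓ') : Mat → Set (c ⊔ ℓ ⊔ ℓ') where
    gen  : ∀ {g} → S g → ⟨ S ⟩ g
    one  : ⟨ S ⟩ 1M
    mul  : ∀ {g h} → ⟨ S ⟩ g → ⟨ S ⟩ h → ⟨ S ⟩ (g *M h)
    inv  : ∀ {g h} → ⟨ S ⟩ g → (g *M h) ≈M 1M → ⟨ S ⟩ h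
    resp : ∀ {g h} → ⟨ S ⟩ g → g ≈M h → ⟨ S ⟩ h

  GensK : Fin d → Mat → Set (c ⊔ ℓ)
  GensK l g = ∃ λ j → ∃₂ λ a b → (j ≢ l) × (g ≈M e j (nextMod j) (lin a b))

  K : Fin d → Mat → Set (c ⊔ ℓ)
  K l = ⟨ GensK l ⟩

  G : Mat → Set (c ⊔ ℓ)
  G = ⟨ (λ g → ∃ λ l → K l g) ⟩

  -- a typed coset g K_l, represented by (l , g)
  TC : Set c
  TC = Fin d × Mat

  type : TC → Fin d
  type (l , g) = l

  rep : TC → Mat
  rep (l , g) = g

  _∈C_ : Mat → TC → Set (c ⊔ ℓ)
  x ∈C (l , g) = ∃ λ k → K l k × ((g *M k) ≈M x)

  -- equality of cosets: same type and g K_l = h K_l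
  _≐_ : TC → TC → Set (c ⊔ ℓ)
  (l , g) ≐ (l' , h) = (l ≡ l') × (h ∈C (l , g))

  -- faces of the coset complex: cosets (of G) of pairwise distinct types
  -- with nonempty common intersection
  IsFace : List TC → Set (c ⊔ ℓ)
  IsFace T = All (λ w → G (rep w)) T × AllPairs _≢_ (map type T) ×
             (∃ λ x → G x × All (x ∈C_) T)

  vFace : Fin d → Fin d → List TC
  vFace i j = map (λ l → (l , 1M))
                  (filter (λ l → ¬? (l ≟ i) ×-dec ¬? (l ≟ j)) (allFin d))

  -- 1-skeleton of the link X_v :
  -- vertices w with {w} = T ∖ v for a face T ⊇ v, edges {w₁,w₂} = T ∖ v
  LinkVertex : Fin d → Fin d → TC → Set (c ⊔ ℓ)
  LinkVertex i j w = G (rep w) × ¬ Any (_≐_ w) (vFace i j) ×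
                     IsFace (vFace i j ++ (w ∷ []))

  LinkV : Fin d → Fin d → Set (c ⊔ ℓ)
  LinkV i j = Σ TC (LinkVertex i j)

  LinkE : (i j : Fin d) → LinkV i j → LinkV i j → Set (c ⊔ ℓ)
  LinkE i j (w₁ , _) (w₂ , _) =
    ¬ (w₁ ≐ w₂) × IsFace (vFace i j ++ (w₁ ∷ w₂ ∷ []))

module Submission where

-- (1) K_l ⊆ U l, where U l consists of the matrices that are unitriangular for the
--     cyclic order of indices starting after l and whose cyclic superdiagonal entries
--     outside row l are linear (of the form at+b): U l contains the generators, is
--     closed under products, and every element of K_l has an inverse in U l.
-- (2) Hence every point of ⋂_{l ≠ i,j} K_l is {i,j}-shaped: off the diagonal it can
--     only be nonzero at (i,i+1) and (j,j+1), and it is determined by these two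
--     linear entries.
-- (3) For link vertices gK_i and hK_j pick points x₁ ∈ gK_i, x₂ ∈ hK_j of that
--     intersection.  Multiplying x₁ by e_{j,j+1}(γ) ∈ K_i and x₂ by e_{i,i+1}(δ) ∈ K_j
--     for suitable linear γ, δ makes them equal, a common point: so gK_i, hK_j span
--     an edge.  Conversely the cosets of a face have distinct types, and every link
--     vertex has type i or j.

open import Defs
open import Level using (_⊔_)
open import Function using (_∘_; id)
open import Algebra.Bundles using (CommutativeMonoid; CommutativeRing; Semiring; Monoid)
import Algebra.Construct.Pointwise as Pointwise
open import Data.Bool using (Bool; true; false; if_then_else_; T)
open import Data.Empty using (⊥-elim)
open import Data.Unit using (tt)
open import Data.Product using (Σ; ∃₂; _×_; _,_; proj₁; proj₂)
open import Data.Sum using (_⊎_; inj₁; inj₂; [_,_])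
open import Data.Nat as ℕ using (ℕ; zero; suc; _≤_; _<_; s≤s; _≡ᵇ_)
import Data.Nat.Properties as ℕₚ
open ℕₚ using (≡ᵇ⇒≡; ≡⇒≡ᵇ)
open import Data.Fin using (Fin; zero; suc; toℕ; fromℕ<; punchIn; punchOut; _≟_)
open import Data.Fin.Properties using (punchInᵢ≢i; punchIn-punchOut; punchIn-injective; toℕ-fromℕ<; toℕ-injective; toℕ<n)
open import Data.Vec.Functional using (Vector; removeAt)
open import Data.List using (List; []; _∷_; map; _++_; allFin)
open import Data.List.Relation.Unary.All as All using (All; []; _∷_) renaming (lookup to lookupAll)
import Data.List.Relation.Unary.All.Properties as All
open import Data.List.Relation.Unary.Any using (Any; here)
open import Data.List.Properties using (map-++)
open import Data.List.Relation.Unary.AllPairs using (AllPairs; []; _∷_)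
import Data.List.Relation.Unary.AllPairs.Properties as AP
open import Data.List.Membership.Propositional.Properties using (∈-map⁺; ∈-filter⁺; ∈-allFin)
open import Relation.Nullary using (¬_; Dec; yes; no)
open import Relation.Nullary.Decidable using (does; ¬?; _×-dec_; _⊎-dec_; dec-true; dec-false)
open import Relation.Unary using (Decidable)
open import Relation.Binary.PropositionalEquality as ≡ using (_≡_; _≢_; cong)
open import Function.Bundles using (_⇔_; mk⇔)

module FiniteSums {c ℓ} (M : CommutativeMonoid c ℓ) where
  open CommutativeMonoid M renaming (_∙_ to _+_; ε to 0#; ∙-congˡ to +-congˡ)
  open import Algebra.Properties.CommutativeMonoid.Sum M public
    using (sum; sum-syntax; sum-cong-≋; sum-remove; sum-replicate-zero; ∑-comm; ∑-distrib-+)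
  open import Relation.Binary.Reasoning.Setoid setoid

  sum-zero : ∀ {n} (t : Vector Carrier n) → (∀ k → t k ≈ 0#) → sum t ≈ 0#
  sum-zero {n} t t≈0 = trans (sum-cong-≋ t≈0) (sum-replicate-zero n)

  sum-single : ∀ {n} (t : Vector Carrier n) i → (∀ k → k ≢ i → t k ≈ 0#) → sum t ≈ t i
  sum-single {suc n} t i t≈0 = begin
    sum t                       ≈⟨ sum-remove t ⟩
    t i + sum (removeAt t i)    ≈⟨ +-congˡ (sum-zero _ (λ k → t≈0 _ (punchInᵢ≢i i k))) ⟩
    t i + 0#                    ≈⟨ identityʳ (t i) ⟩
    t i                         ∎

  sum-pair : ∀ {n} (t : Vector Carrier n) {i j} (i≢j : i ≢ j) →
             (∀ k → k ≢ i → k ≢ j → t k ≈ 0#) → sum t ≈ t i + t j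
  sum-pair {suc n} t {i} {j} i≢j t≈0 = begin
    sum t                                   ≈⟨ sum-remove t ⟩
    t i + sum (removeAt t i)                ≈⟨ +-congˡ (sum-single (removeAt t i) (punchOut i≢j) off-j) ⟩
    t i + t (punchIn i (punchOut i≢j))      ≡⟨ cong (λ k → t i + t k) (punchIn-punchOut i≢j) ⟩
    t i + t j                               ∎
    where
    off-j : ∀ k → k ≢ punchOut i≢j → t (punchIn i k) ≈ 0#
    off-j k k≢ = t≈0 _ (punchInᵢ≢i i k)
      (λ eq → k≢ (punchIn-injective i k _ (≡.trans eq (≡.sym (punchIn-punchOut i≢j)))))

  -- Any function defined by the same recursion as `sum` is `sum`; Defs defines its
  -- sums (sumFin, sumR) this way.
  recursive-sum : (Σ′ : ∀ n → Vector Carrier n → Carrier) →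
                  (∀ t → Σ′ 0 t ≡ 0#) →
                  (∀ n t → Σ′ (suc n) t ≡ t zero + Σ′ n (λ k → t (suc k))) →
                  ∀ n t → Σ′ n t ≈ sum t
  recursive-sum Σ′ Σ′-zero Σ′-suc zero    t = reflexive (Σ′-zero t)
  recursive-sum Σ′ Σ′-zero Σ′-suc (suc n) t =
    trans (reflexive (Σ′-suc n t)) (+-congˡ (recursive-sum Σ′ Σ′-zero Σ′-suc n (λ k → t (suc k))))

  sum²-cong : ∀ {m n} {t t′ : Fin m → Fin n → Carrier} → (∀ a b → t a b ≈ t′ a b) →
              ∑[ a < m ] ∑[ b < n ] t a b ≈ ∑[ a < m ] ∑[ b < n ] t′ a b
  sum²-cong t≈t′ = sum-cong-≋ (λ a → sum-cong-≋ (t≈t′ a))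

  sum-rotate : ∀ {l m n} (t : Fin l → Fin m → Fin n → Carrier) →
               ∑[ u < l ] ∑[ a < m ] ∑[ b < n ] t u a b ≈ ∑[ a < m ] ∑[ b < n ] ∑[ u < l ] t u a b
  sum-rotate {l} {m} {n} t =
    trans (∑-comm (λ u a → ∑[ b < n ] t u a b)) (sum-cong-≋ {m} (λ a → ∑-comm (λ u b → t u a b)))

-- The matrix size d is a
-- parameter of Defs' Construction only; nothing here depends on it.
module TruncatedPolynomials {c ℓ} (F : CommutativeRing c ℓ) (s d : ℕ) where
  open CommutativeRing F
  open Construction F s d using (R; _≈R_; _+R_; _*R_; 0R; 1R; sumFin)
  open FiniteSums +-commutativeMonoid
  open import Algebra.Properties.Semiring.Sum semiring using (*-distribˡ-sum)
  open import Relation.Binary.Reasoning.Setoid setoid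

  -- The Iverson bracket: guard b x is x if b holds and 0 otherwise.  Defs' product
  -- is a double sum of bracketed terms; the lemmas below move brackets through the
  -- ring operations and sums.
  guard : Bool → Carrier → Carrier
  guard b x = if b then x else 0#

  guard-true : ∀ {b} x → T b → guard b x ≈ x
  guard-true {true} x _ = refl

  guard-false : ∀ {b} x → ¬ T b → guard b x ≈ 0#
  guard-false {true}  x ¬b = ⊥-elim (¬b tt)
  guard-false {false} x ¬b = refl

  guard-cong : ∀ b {x y} → x ≈ y → guard b x ≈ guard b y
  guard-cong true  x≈y = x≈y
  guard-cong false x≈y = refl

  guard-0 : ∀ b → guard b 0# ≈ 0#
  guard-0 true  = refl
  guard-0 false = refl

  guard-+ : ∀ b x y → guard b (x + y) ≈ guard b x + guard b y
  guard-+ true  x y = refl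
  guard-+ false x y = sym (+-identityˡ 0#)

  guard-*ˡ : ∀ b x y → x * guard b y ≈ guard b (x * y)
  guard-*ˡ true  x y = refl
  guard-*ˡ false x y = zeroʳ x

  guard-*ʳ : ∀ b x y → guard b x * y ≈ guard b (x * y)
  guard-*ʳ true  x y = refl
  guard-*ʳ false x y = zeroˡ y

  guard-sum : ∀ b {n} (t : Vector Carrier n) → guard b (sum t) ≈ sum (λ k → guard b (t k))
  guard-sum true  t = refl
  guard-sum false t = sym (sum-zero (λ k → guard false (t k)) (λ _ → refl))

  _≡[_+_] : Fin s → Fin s → Fin s → Bool
  k ≡[ m + n ] = toℕ m ℕ.+ toℕ n ≡ᵇ toℕ k

  *R-sum : ∀ f g k → (f *R g) k ≈ ∑[ m < s ] ∑[ n < s ] guard (k ≡[ m + n ]) (f m * g n)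
  *R-sum f g k = trans (sumFin-sum _) (sum-cong-≋ {s} (λ m → sumFin-sum (λ n → guard (k ≡[ m + n ]) (f m * g n))))
    where
    sumFin-sum : ∀ (t : Vector Carrier s) → sumFin s t ≈ sum t
    sumFin-sum = recursive-sum sumFin (λ _ → ≡.refl) (λ _ _ → ≡.refl) s

  -- Summing a bracket [a = u] over the exponents u < s picks out u = a; this is
  -- harmless when the outer bracket forces a < s.
  collapse : ∀ (P : ℕ → Bool) a X → (T (P a) → a < s) →
             ∑[ u < s ] guard (P (toℕ u)) (guard (a ≡ᵇ toℕ u) X) ≈ guard (P a) X
  collapse P a X Pa⇒a<s with a ℕ.<? s
  ... | yes a<s = begin
    ∑[ u < s ] guard (P (toℕ u)) (guard (a ≡ᵇ toℕ u) X)
      ≈⟨ sum-single _ â off-â ⟩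
    guard (P (toℕ â)) (guard (a ≡ᵇ toℕ â) X)
      ≈⟨ guard-cong (P (toℕ â)) (guard-true X (≡⇒≡ᵇ a (toℕ â) (≡.sym toℕ-â))) ⟩
    guard (P (toℕ â)) X
      ≡⟨ cong (λ b → guard (P b) X) toℕ-â ⟩
    guard (P a) X ∎
    where
    â : Fin s
    â = fromℕ< a<s
    toℕ-â : toℕ â ≡ a
    toℕ-â = toℕ-fromℕ< a<s
    off-â : ∀ u → u ≢ â → guard (P (toℕ u)) (guard (a ≡ᵇ toℕ u) X) ≈ 0#
    off-â u u≢â = trans (guard-cong (P (toℕ u)) (guard-false X λ a≡u →
        u≢â (toℕ-injective (≡.trans (≡.sym (≡ᵇ⇒≡ a (toℕ u) a≡u)) (≡.sym toℕ-â)))))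
      (guard-0 (P (toℕ u)))
  ... | no a≮s = begin
    ∑[ u < s ] guard (P (toℕ u)) (guard (a ≡ᵇ toℕ u) X)
      ≈⟨ sum-zero _ (λ u → trans (guard-cong (P (toℕ u)) (guard-false X λ a≡u →
           a≮s (≡.subst (_< s) (≡.sym (≡ᵇ⇒≡ a (toℕ u) a≡u)) (toℕ<n u)))) (guard-0 (P (toℕ u)))) ⟩
    0#
      ≈⟨ guard-false X (λ Pa → a≮s (Pa⇒a<s Pa)) ⟨
    guard (P a) X ∎

  sum-coefficient : ∀ (t : Vector Carrier s) k → ∑[ n < s ] guard (toℕ n ≡ᵇ toℕ k) (t n) ≈ t k
  sum-coefficient t k = trans (sum-single _ k off-k) (guard-true (t k) (≡⇒≡ᵇ (toℕ k) (toℕ k) ≡.refl))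
    where
    off-k : ∀ n → n ≢ k → guard (toℕ n ≡ᵇ toℕ k) (t n) ≈ 0#
    off-k n n≢k = guard-false (t n) (λ n≡k → n≢k (toℕ-injective (≡ᵇ⇒≡ (toℕ n) (toℕ k) n≡k)))

  1R-bracket : ∀ m → 1R m ≈ guard (0 ≡ᵇ toℕ m) 1#
  1R-bracket m with toℕ m
  ... | zero  = refl
  ... | suc _ = refl

  summand-boundˡ : ∀ a b (k : Fin s) → T (a ℕ.+ b ≡ᵇ toℕ k) → a < s
  summand-boundˡ a b k a+b≡k = ℕₚ.≤-<-trans (≡.subst (a ≤_) (≡ᵇ⇒≡ _ _ a+b≡k) (ℕₚ.m≤m+n a b)) (toℕ<n k)

  summand-boundʳ : ∀ a b (k : Fin s) → T (a ℕ.+ b ≡ᵇ toℕ k) → b < s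
  summand-boundʳ a b k a+b≡k = ℕₚ.≤-<-trans (≡.subst (b ≤_) (≡ᵇ⇒≡ _ _ a+b≡k) (ℕₚ.m≤n+m b a)) (toℕ<n k)

  *R-cong : ∀ {x y u v} → x ≈R y → u ≈R v → (x *R u) ≈R (y *R v)
  *R-cong {x} {y} {u} {v} x≈y u≈v k = begin
    (x *R u) k                                                ≈⟨ *R-sum x u k ⟩
    ∑[ m < s ] ∑[ n < s ] guard (k ≡[ m + n ]) (x m * u n)
      ≈⟨ sum²-cong (λ m n → guard-cong (k ≡[ m + n ]) (*-cong (x≈y m) (u≈v n))) ⟩
    ∑[ m < s ] ∑[ n < s ] guard (k ≡[ m + n ]) (y m * v n)   ≈⟨ *R-sum y v k ⟨
    (y *R v) k                                                ∎

  *R-distribˡ : ∀ x y z → (x *R (y +R z)) ≈R ((x *R y) +R (x *R z))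
  *R-distribˡ x y z k = begin
    (x *R (y +R z)) k                                                   ≈⟨ *R-sum x (y +R z) k ⟩
    ∑[ m < s ] ∑[ n < s ] guard (k ≡[ m + n ]) (x m * (y n + z n))
      ≈⟨ sum²-cong (λ m n → trans (guard-cong (k ≡[ m + n ]) (distribˡ _ _ _)) (guard-+ _ _ _)) ⟩
    ∑[ m < s ] ∑[ n < s ] (guard (k ≡[ m + n ]) (x m * y n) + guard (k ≡[ m + n ]) (x m * z n))
      ≈⟨ sum-cong-≋ {s} (λ m → ∑-distrib-+ {s} _ _) ⟩
    ∑[ m < s ] (∑[ n < s ] guard (k ≡[ m + n ]) (x m * y n) + ∑[ n < s ] guard (k ≡[ m + n ]) (x m * z n))
      ≈⟨ ∑-distrib-+ {s} _ _ ⟩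
    (∑[ m < s ] ∑[ n < s ] guard (k ≡[ m + n ]) (x m * y n)) + (∑[ m < s ] ∑[ n < s ] guard (k ≡[ m + n ]) (x m * z n))
      ≈⟨ +-cong (*R-sum x y k) (*R-sum x z k) ⟨
    (x *R y) k + (x *R z) k                                             ∎

  *R-zeroˡ : ∀ x → (0R *R x) ≈R 0R
  *R-zeroˡ x k = trans (*R-sum 0R x k)
    (sum-zero {s} _ (λ m → sum-zero {s} _ (λ n → trans (guard-cong (k ≡[ m + n ]) (zeroˡ (x n))) (guard-0 (k ≡[ m + n ])))))

  *R-identityˡ : ∀ x → (1R *R x) ≈R x
  *R-identityˡ x k = begin
    (1R *R x) k                                                              ≈⟨ *R-sum 1R x k ⟩
    ∑[ m < s ] ∑[ n < s ] guard (k ≡[ m + n ]) (1R m * x n)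
      ≈⟨ sum²-cong (λ m n → guard-cong (k ≡[ m + n ]) (unit m n)) ⟩
    ∑[ m < s ] ∑[ n < s ] guard (k ≡[ m + n ]) (guard (0 ≡ᵇ toℕ m) (x n))  ≈⟨ ∑-comm {s} {s} _ ⟩
    ∑[ n < s ] ∑[ m < s ] guard (k ≡[ m + n ]) (guard (0 ≡ᵇ toℕ m) (x n))
      ≈⟨ sum-cong-≋ {s} (λ n → collapse (λ a → a ℕ.+ toℕ n ≡ᵇ toℕ k) 0 (x n) (summand-boundˡ 0 (toℕ n) k)) ⟩
    ∑[ n < s ] guard (toℕ n ≡ᵇ toℕ k) (x n)                                 ≈⟨ sum-coefficient x k ⟩
    x k                                                                      ∎
    where
    unit : ∀ m n → 1R m * x n ≈ guard (0 ≡ᵇ toℕ m) (x n)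
    unit m n = trans (*-congʳ (1R-bracket m)) (trans (guard-*ʳ _ 1# (x n)) (guard-cong _ (*-identityˡ (x n))))

  -- R is commutative (swap the two summations), so the right-hand laws follow
  -- from the left-hand ones.
  *R-comm : ∀ f g → (f *R g) ≈R (g *R f)
  *R-comm f g k = begin
    (f *R g) k                                                ≈⟨ *R-sum f g k ⟩
    ∑[ m < s ] ∑[ n < s ] guard (k ≡[ m + n ]) (f m * g n)   ≈⟨ ∑-comm {s} {s} _ ⟩
    ∑[ n < s ] ∑[ m < s ] guard (k ≡[ m + n ]) (f m * g n)   ≈⟨ sum²-cong swap ⟩
    ∑[ n < s ] ∑[ m < s ] guard (k ≡[ n + m ]) (g n * f m)   ≈⟨ *R-sum g f k ⟨
    (g *R f) k                                                ∎
    where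
    swap : ∀ n m → guard (k ≡[ m + n ]) (f m * g n) ≈ guard (k ≡[ n + m ]) (g n * f m)
    swap n m = trans (guard-cong (k ≡[ m + n ]) (*-comm (f m) (g n)))
      (reflexive (cong (λ e → guard (e ≡ᵇ toℕ k) (g n * f m)) (ℕₚ.+-comm (toℕ m) (toℕ n))))

  *R-distribʳ : ∀ x y z → ((y +R z) *R x) ≈R ((y *R x) +R (z *R x))
  *R-distribʳ x y z k = trans (*R-comm (y +R z) x k)
    (trans (*R-distribˡ x y z k) (+-cong (*R-comm x y k) (*R-comm x z k)))

  *R-zeroʳ : ∀ x → (x *R 0R) ≈R 0R
  *R-zeroʳ x k = trans (*R-comm x 0R k) (*R-zeroˡ x k)

  *R-identityʳ : ∀ x → (x *R 1R) ≈R x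
  *R-identityʳ x k = trans (*R-comm x 1R k) (*R-identityˡ x k)

  expandˡ : ∀ B (P : Fin s → Fin s → Bool) (t : Fin s → Fin s → Carrier) x →
            guard B (x * ∑[ a < s ] ∑[ b < s ] guard (P a b) (t a b)) ≈
            ∑[ a < s ] ∑[ b < s ] guard B (guard (P a b) (x * t a b))
  expandˡ B P t x = begin
    guard B (x * ∑[ a < s ] ∑[ b < s ] guard (P a b) (t a b))
      ≈⟨ guard-cong B (*-distribˡ-sum {s} x _) ⟩
    guard B (∑[ a < s ] (x * ∑[ b < s ] guard (P a b) (t a b)))
      ≈⟨ guard-sum B {s} _ ⟩
    ∑[ a < s ] guard B (x * ∑[ b < s ] guard (P a b) (t a b))
      ≈⟨ sum-cong-≋ {s} (λ a → trans (guard-cong B (*-distribˡ-sum {s} x _)) (guard-sum B {s} _)) ⟩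
    ∑[ a < s ] ∑[ b < s ] guard B (x * guard (P a b) (t a b))
      ≈⟨ sum²-cong (λ a b → guard-cong B (guard-*ˡ (P a b) x (t a b))) ⟩
    ∑[ a < s ] ∑[ b < s ] guard B (guard (P a b) (x * t a b)) ∎

  expandʳ : ∀ B (P : Fin s → Fin s → Bool) (t : Fin s → Fin s → Carrier) y →
            guard B ((∑[ a < s ] ∑[ b < s ] guard (P a b) (t a b)) * y) ≈
            ∑[ a < s ] ∑[ b < s ] guard B (guard (P a b) (t a b * y))
  expandʳ B P t y = trans (guard-cong B (*-comm _ y)) (trans (expandˡ B P t y)
    (sum²-cong (λ a b → guard-cong B (guard-cong (P a b) (*-comm y (t a b))))))

  -- Both bracketings of a triple product have as t^k-coefficient
  -- ∑_{a+b+c=k} f_a g_b h_c.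
  triple : R → R → R → Fin s → Carrier
  triple f g h k = ∑[ a < s ] ∑[ b < s ] ∑[ c < s ]
    guard (toℕ a ℕ.+ toℕ b ℕ.+ toℕ c ≡ᵇ toℕ k) (f a * g b * h c)

  *R-triple-left : ∀ f g h k → ((f *R g) *R h) k ≈ triple f g h k
  *R-triple-left f g h k = begin
    ((f *R g) *R h) k
      ≈⟨ *R-sum (f *R g) h k ⟩
    ∑[ u < s ] ∑[ c < s ] guard (k ≡[ u + c ]) ((f *R g) u * h c)
      ≈⟨ sum²-cong (λ u c → trans (guard-cong (k ≡[ u + c ]) (*-congʳ (*R-sum f g u)))
                                   (expandʳ (k ≡[ u + c ]) (λ a b → u ≡[ a + b ]) (λ a b → f a * g b) (h c))) ⟩
    ∑[ u < s ] ∑[ c < s ] ∑[ a < s ] ∑[ b < s ] guard (k ≡[ u + c ]) (guard (u ≡[ a + b ]) (f a * g b * h c))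
      ≈⟨ ∑-comm {s} {s} _ ⟩
    ∑[ c < s ] ∑[ u < s ] ∑[ a < s ] ∑[ b < s ] guard (k ≡[ u + c ]) (guard (u ≡[ a + b ]) (f a * g b * h c))
      ≈⟨ sum-cong-≋ {s} (λ c → sum-rotate {s} {s} {s} _) ⟩
    ∑[ c < s ] ∑[ a < s ] ∑[ b < s ] ∑[ u < s ] guard (k ≡[ u + c ]) (guard (u ≡[ a + b ]) (f a * g b * h c))
      ≈⟨ sum-cong-≋ {s} (λ c → sum²-cong (λ a b →
           collapse (λ v → v ℕ.+ toℕ c ≡ᵇ toℕ k) (toℕ a ℕ.+ toℕ b) (f a * g b * h c)
                    (summand-boundˡ (toℕ a ℕ.+ toℕ b) (toℕ c) k))) ⟩
    ∑[ c < s ] ∑[ a < s ] ∑[ b < s ] guard (toℕ a ℕ.+ toℕ b ℕ.+ toℕ c ≡ᵇ toℕ k) (f a * g b * h c)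
      ≈⟨ sum-rotate {s} {s} {s} _ ⟩
    triple f g h k ∎

  *R-triple-right : ∀ f g h k → (f *R (g *R h)) k ≈ triple f g h k
  *R-triple-right f g h k = begin
    (f *R (g *R h)) k
      ≈⟨ *R-sum f (g *R h) k ⟩
    ∑[ a < s ] ∑[ v < s ] guard (k ≡[ a + v ]) (f a * (g *R h) v)
      ≈⟨ sum²-cong (λ a v → trans (guard-cong (k ≡[ a + v ]) (*-congˡ (*R-sum g h v)))
                                   (expandˡ (k ≡[ a + v ]) (λ b c → v ≡[ b + c ]) (λ b c → g b * h c) (f a))) ⟩
    ∑[ a < s ] ∑[ v < s ] ∑[ b < s ] ∑[ c < s ] guard (k ≡[ a + v ]) (guard (v ≡[ b + c ]) (f a * (g b * h c)))
      ≈⟨ sum-cong-≋ {s} (λ a → sum-rotate {s} {s} {s} _) ⟩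
    ∑[ a < s ] ∑[ b < s ] ∑[ c < s ] ∑[ v < s ] guard (k ≡[ a + v ]) (guard (v ≡[ b + c ]) (f a * (g b * h c)))
      ≈⟨ sum-cong-≋ {s} (λ a → sum²-cong (λ b c →
           collapse (λ v → toℕ a ℕ.+ v ≡ᵇ toℕ k) (toℕ b ℕ.+ toℕ c) (f a * (g b * h c))
                    (summand-boundʳ (toℕ a) (toℕ b ℕ.+ toℕ c) k))) ⟩
    ∑[ a < s ] ∑[ b < s ] ∑[ c < s ] guard (toℕ a ℕ.+ (toℕ b ℕ.+ toℕ c) ≡ᵇ toℕ k) (f a * (g b * h c))
      ≈⟨ sum-cong-≋ {s} (λ a → sum²-cong (λ b c → reassociate (toℕ a) (toℕ b) (toℕ c) (f a) (g b) (h c))) ⟩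
    triple f g h k ∎
    where
    reassociate : ∀ a b c x y z → guard (a ℕ.+ (b ℕ.+ c) ≡ᵇ toℕ k) (x * (y * z)) ≈
                                  guard (a ℕ.+ b ℕ.+ c ≡ᵇ toℕ k) (x * y * z)
    reassociate a b c x y z = begin
      guard (a ℕ.+ (b ℕ.+ c) ≡ᵇ toℕ k) (x * (y * z))
        ≡⟨ cong (λ e → guard (e ≡ᵇ toℕ k) (x * (y * z))) (ℕₚ.+-assoc a b c) ⟨
      guard (a ℕ.+ b ℕ.+ c ≡ᵇ toℕ k) (x * (y * z))
        ≈⟨ guard-cong (a ℕ.+ b ℕ.+ c ≡ᵇ toℕ k) (*-assoc x y z) ⟨
      guard (a ℕ.+ b ℕ.+ c ≡ᵇ toℕ k) (x * y * z) ∎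

  *R-assoc : ∀ f g h → ((f *R g) *R h) ≈R (f *R (g *R h))
  *R-assoc f g h k = trans (*R-triple-left f g h k) (sym (*R-triple-right f g h k))

  Rˢ : Semiring c ℓ
  Rˢ = record
    { Carrier    = R
    ; _≈_        = _≈R_
    ; _+_        = _+R_
    ; _*_        = _*R_
    ; 0#         = 0R
    ; 1#         = 1R
    ; isSemiring = record
      { isSemiringWithoutAnnihilatingZero = record
        { +-isCommutativeMonoid = Pointwise.isCommutativeMonoid (Fin s) +-isCommutativeMonoid
        ; *-cong                = *R-cong
        ; *-assoc               = *R-assoc
        ; *-identity            = *R-identityˡ , *R-identityʳ
        ; distrib               = *R-distribˡ , *R-distribʳ
        }
      ; zero = *R-zeroˡ , *R-zeroʳ
      }
    }

module Matrices {c ℓ} (F : CommutativeRing c ℓ) (s d : ℕ) where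
  open Construction F s d
  open TruncatedPolynomials F s d using (Rˢ)
  open Semiring Rˢ using (+-commutativeMonoid; *-cong; *-congˡ; *-congʳ; *-assoc;
    *-identityˡ; *-identityʳ; zeroˡ; zeroʳ) renaming (setoid to R-setoid; refl to ≈R-refl;
    sym to ≈R-sym; trans to ≈R-trans)
  open FiniteSums +-commutativeMonoid
  open import Algebra.Properties.Semiring.Sum Rˢ using (*-distribˡ-sum; *-distribʳ-sum)
  open import Relation.Binary.Reasoning.Setoid R-setoid

  *M-entry : ∀ A B i k → (A *M B) i k ≈R (∑[ j < d ] (A i j *R B j k))
  *M-entry A B i k = recursive-sum sumR (λ _ → ≡.refl) (λ _ _ → ≡.refl) d _

  *M-cong : ∀ {A A′ B B′} → A ≈M A′ → B ≈M B′ → (A *M B) ≈M (A′ *M B′)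
  *M-cong {A} {A′} {B} {B′} A≈A′ B≈B′ i k = begin
    (A *M B) i k                  ≈⟨ *M-entry A B i k ⟩
    ∑[ j < d ] (A i j *R B j k)   ≈⟨ sum-cong-≋ {d} (λ j → *-cong (A≈A′ i j) (B≈B′ j k)) ⟩
    ∑[ j < d ] (A′ i j *R B′ j k) ≈⟨ *M-entry A′ B′ i k ⟨
    (A′ *M B′) i k                ∎

  *M-assoc : ∀ A B C → ((A *M B) *M C) ≈M (A *M (B *M C))
  *M-assoc A B C i k = begin
    ((A *M B) *M C) i k                                     ≈⟨ *M-entry (A *M B) C i k ⟩
    ∑[ j < d ] ((A *M B) i j *R C j k)
      ≈⟨ sum-cong-≋ {d} (λ j → ≈R-trans (*-congʳ (*M-entry A B i j)) (*-distribʳ-sum {d} (C j k) _)) ⟩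
    ∑[ j < d ] ∑[ m < d ] ((A i m *R B m j) *R C j k)      ≈⟨ ∑-comm {d} {d} _ ⟩
    ∑[ m < d ] ∑[ j < d ] ((A i m *R B m j) *R C j k)
      ≈⟨ sum²-cong (λ m j → *-assoc (A i m) (B m j) (C j k)) ⟩
    ∑[ m < d ] ∑[ j < d ] (A i m *R (B m j *R C j k))
      ≈⟨ sum-cong-≋ {d} (λ m → ≈R-trans (≈R-sym (*-distribˡ-sum {d} (A i m) _)) (*-congˡ (≈R-sym (*M-entry B C m k)))) ⟩
    ∑[ m < d ] (A i m *R (B *M C) m k)                      ≈⟨ *M-entry A (B *M C) i k ⟨
    (A *M (B *M C)) i k                                     ∎

  1M-diag : ∀ a → 1M a a ≈R 1R
  1M-diag a with a ≟ a
  ... | yes _   = ≈R-refl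
  ... | no  a≢a = ⊥-elim (a≢a ≡.refl)

  1M-off : ∀ a b → a ≢ b → 1M a b ≈R 0R
  1M-off a b a≢b with a ≟ b
  ... | yes a≡b = ⊥-elim (a≢b a≡b)
  ... | no  _   = ≈R-refl

  *M-identityˡ : ∀ A → (1M *M A) ≈M A
  *M-identityˡ A i k = begin
    (1M *M A) i k                ≈⟨ *M-entry 1M A i k ⟩
    ∑[ j < d ] (1M i j *R A j k) ≈⟨ sum-single _ i (λ j j≢i → ≈R-trans (*-congʳ (1M-off i j (j≢i ∘ ≡.sym))) (zeroˡ _)) ⟩
    1M i i *R A i k              ≈⟨ ≈R-trans (*-congʳ (1M-diag i)) (*-identityˡ _) ⟩
    A i k                        ∎

  *M-identityʳ : ∀ A → (A *M 1M) ≈M A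
  *M-identityʳ A i k = begin
    (A *M 1M) i k                ≈⟨ *M-entry A 1M i k ⟩
    ∑[ j < d ] (A i j *R 1M j k) ≈⟨ sum-single _ k (λ j j≢k → ≈R-trans (*-congˡ (1M-off j k j≢k)) (zeroʳ _)) ⟩
    A i k *R 1M k k              ≈⟨ ≈R-trans (*-congˡ (1M-diag k)) (*-identityʳ _) ⟩
    A i k                        ∎

  Matˢ : Monoid c ℓ
  Matˢ = record
    { Carrier  = Mat
    ; _≈_      = _≈M_
    ; _∙_      = _*M_
    ; ε        = 1M
    ; isMonoid = record
      { isSemigroup = record
        { isMagma = record
          { isEquivalence = record
            { refl  = λ _ _ → ≈R-refl
            ; sym   = λ A≈B i j → ≈R-sym (A≈B i j)
            ; trans = λ A≈B B≈C i j → ≈R-trans (A≈B i j) (B≈C i j)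
            }
          ; ∙-cong = *M-cong
          }
        ; assoc = *M-assoc
        }
      ; identity = *M-identityˡ , *M-identityʳ
      }
    }

  e-diag : ∀ i j r a → e i j r a a ≈R 1R
  e-diag i j r a with a ≟ a
  ... | yes _   = ≈R-refl
  ... | no  a≢a = ⊥-elim (a≢a ≡.refl)

  e-hit : ∀ i j r → i ≢ j → e i j r i j ≈R r
  e-hit i j r i≢j with i ≟ j | i ≟ i | j ≟ j
  ... | yes i≡j | _       | _       = ⊥-elim (i≢j i≡j)
  ... | no _    | yes _   | yes _   = ≈R-refl
  ... | no _    | no i≢i  | _       = ⊥-elim (i≢i ≡.refl)
  ... | no _    | yes _   | no j≢j  = ⊥-elim (j≢j ≡.refl)

  e-miss : ∀ i j r a b → a ≢ b → ¬ (a ≡ i × b ≡ j) → e i j r a b ≈R 0R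
  e-miss i j r a b a≢b not-ij with a ≟ b | a ≟ i | b ≟ j
  ... | yes a≡b | _       | _       = ⊥-elim (a≢b a≡b)
  ... | no _    | yes a≡i | yes b≡j = ⊥-elim (not-ij (a≡i , b≡j))
  ... | no _    | yes _   | no _    = ≈R-refl
  ... | no _    | no _    | _       = ≈R-refl

  e-cong : ∀ i j {r r′} → r ≈R r′ → e i j r ≈M e i j r′
  e-cong i j r≈r′ a b with a ≟ b | a ≟ i | b ≟ j
  ... | yes _ | _     | _     = ≈R-refl
  ... | no _  | yes _ | yes _ = r≈r′
  ... | no _  | yes _ | no _  = ≈R-refl
  ... | no _  | no _  | _     = ≈R-refl

-- The cyclic order on Fin d (d = suc n) read off after the index l:
-- pos l m is the position of m in the sequence l+1, l+2, …, l (indices mod d),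
-- so l itself comes last and consecutive indices other than l have consecutive
-- positions.
module CyclicOrder (n : ℕ) where
  open import Data.Nat using (_+_; _∸_)

  D : ℕ
  D = suc n

  nextMod-cases : (m : Fin D) →
    (toℕ m < n × toℕ (nextMod m) ≡ suc (toℕ m)) ⊎ (toℕ m ≡ n × toℕ (nextMod m) ≡ 0)
  nextMod-cases m with toℕ m ℕ.<? n
  ... | yes m<n = inj₁ (m<n , toℕ-fromℕ< (s≤s m<n))
  ... | no  m≮n = inj₂ (ℕₚ.≤-antisym (ℕₚ.≤-pred (toℕ<n m)) (ℕₚ.≮⇒≥ m≮n) , ≡.refl)

  posℕ : ℕ → ℕ → ℕ
  posℕ l m with l ℕ.<? m
  ... | yes _ = m ∸ suc l
  ... | no  _ = m + D ∸ suc l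

  posℕ-cases : ∀ l m → l < D →
    (l < m × posℕ l m + suc l ≡ m) ⊎ (m ≤ l × posℕ l m + suc l ≡ m + D)
  posℕ-cases l m l<D with l ℕ.<? m
  ... | yes l<m = inj₁ (l<m , ℕₚ.m∸n+n≡m l<m)
  ... | no  l≮m = inj₂ (ℕₚ.≮⇒≥ l≮m , ℕₚ.m∸n+n≡m (ℕₚ.≤-trans l<D (ℕₚ.m≤n+m D m)))

  pos : Fin D → Fin D → ℕ
  pos l m = posℕ (toℕ l) (toℕ m)

  pos<D : ∀ l m → pos l m < D
  pos<D l m with posℕ-cases (toℕ l) (toℕ m) (toℕ<n l)
  ... | inj₁ (_ , p+l+1≡m) =
    ℕₚ.<-trans (ℕₚ.m+n≤o⇒m≤o (suc _) (≡.subst (_≤ toℕ m) (ℕₚ.+-suc _ (toℕ l)) (ℕₚ.≤-reflexive p+l+1≡m))) (toℕ<n m)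
  ... | inj₂ (m≤l , p+l+1≡m+D) = ℕₚ.+-cancelʳ-< (suc (toℕ l)) (pos l m) D (begin-strict
    pos l m + suc (toℕ l) ≡⟨ p+l+1≡m+D ⟩
    toℕ m + D             ≤⟨ ℕₚ.+-monoˡ-≤ D m≤l ⟩
    toℕ l + D             <⟨ ℕₚ.n<1+n _ ⟩
    suc (toℕ l + D)       ≡⟨ ℕₚ.+-comm (suc (toℕ l)) D ⟩
    D + suc (toℕ l)       ∎)
    where open ℕₚ.≤-Reasoning

  -- Distinct indices have distinct positions (the two cases of posℕ-cases are told
  -- apart by whether pos + l + 1 lies below D).
  pos-injective : ∀ l {a b} → pos l a ≡ pos l b → a ≡ b
  pos-injective l {a} {b} pa≡pb
    with posℕ-cases (toℕ l) (toℕ a) (toℕ<n l) | posℕ-cases (toℕ l) (toℕ b) (toℕ<n l)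
  ... | inj₁ (_ , ea) | inj₁ (_ , eb) =
    toℕ-injective (≡.trans (≡.sym ea) (≡.trans (cong (_+ suc (toℕ l)) pa≡pb) eb))
  ... | inj₂ (_ , ea) | inj₂ (_ , eb) =
    toℕ-injective (ℕₚ.+-cancelʳ-≡ D _ _ (≡.trans (≡.sym ea) (≡.trans (cong (_+ suc (toℕ l)) pa≡pb) eb)))
  ... | inj₁ (_ , ea) | inj₂ (_ , eb) = ⊥-elim (ℕₚ.<⇒≱ (toℕ<n a)
    (≡.subst (D ≤_) (≡.trans (≡.sym eb) (≡.trans (cong (_+ suc (toℕ l)) (≡.sym pa≡pb)) ea)) (ℕₚ.m≤n+m D (toℕ b))))
  ... | inj₂ (_ , ea) | inj₁ (_ , eb) = ⊥-elim (ℕₚ.<⇒≱ (toℕ<n b)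
    (≡.subst (D ≤_) (≡.trans (≡.sym ea) (≡.trans (cong (_+ suc (toℕ l)) pa≡pb) eb)) (ℕₚ.m≤n+m D (toℕ a))))

  pos-last : ∀ l → suc (pos l l) ≡ D
  pos-last l with posℕ-cases (toℕ l) (toℕ l) (toℕ<n l)
  ... | inj₁ (l<l , _) = ⊥-elim (ℕₚ.<-irrefl ≡.refl l<l)
  ... | inj₂ (_ , e) = ℕₚ.+-cancelʳ-≡ (toℕ l) (suc (pos l l)) D
    (≡.trans (≡.sym (ℕₚ.+-suc (pos l l) (toℕ l))) (≡.trans e (ℕₚ.+-comm (toℕ l) D)))

  pos≤last : ∀ l m → pos l m ≤ pos l l
  pos≤last l m = ℕₚ.≤-pred (≡.subst (pos l m <_) (≡.sym (pos-last l)) (pos<D l m))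

  consecutive : ∀ {x y a} k → x + k ≡ a → y + k ≡ suc a → y ≡ suc x
  consecutive k e₁ e₂ = ℕₚ.+-cancelʳ-≡ k _ _ (≡.trans e₂ (cong suc (≡.sym e₁)))

  pos-next : ∀ l m → m ≢ l → pos l (nextMod m) ≡ suc (pos l m)
  pos-next l m m≢l with nextMod-cases m
  ... | inj₁ (m<n , next≡m+1) rewrite next≡m+1
      with posℕ-cases (toℕ l) (toℕ m) (toℕ<n l) | posℕ-cases (toℕ l) (suc (toℕ m)) (toℕ<n l)
  ...   | inj₁ (_ , e₁)   | inj₁ (_ , e₂)   = consecutive (suc (toℕ l)) e₁ e₂
  ...   | inj₁ (l<m , _)  | inj₂ (m+1≤l , _) = ⊥-elim (ℕₚ.<-asym l<m m+1≤l)
  ...   | inj₂ (m≤l , _)  | inj₁ (l<m+1 , _) = ⊥-elim (m≢l (toℕ-injective (ℕₚ.≤-antisym m≤l (ℕₚ.≤-pred l<m+1))))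
  ...   | inj₂ (_ , e₁)   | inj₂ (_ , e₂)   = consecutive (suc (toℕ l)) e₁ e₂
  pos-next l m m≢l | inj₂ (m≡n , next≡0) rewrite next≡0
      with posℕ-cases (toℕ l) (toℕ m) (toℕ<n l) | posℕ-cases (toℕ l) 0 (toℕ<n l)
  ...   | _              | inj₁ (() , _)
  ...   | inj₁ (_ , e₁)  | inj₂ (_ , e₂) = consecutive (suc (toℕ l)) e₁ (≡.trans e₂ (cong suc (≡.sym m≡n)))
  ...   | inj₂ (m≤l , _) | inj₂ _ =
    ⊥-elim (m≢l (toℕ-injective (ℕₚ.≤-antisym m≤l (≡.subst (toℕ l ≤_) (≡.sym m≡n) (ℕₚ.≤-pred (toℕ<n l))))))

  -- Since d ≥ 2 (there are two distinct indices), nextMod has no fixed point.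
  nextMod-moves : ∀ {a l : Fin D} → a ≢ l → nextMod a ≢ a
  nextMod-moves {a} {l} a≢l next≡a =
    ℕₚ.1+n≢n (≡.trans (≡.sym (pos-next l a a≢l)) (cong (pos l) next≡a))

module Unitriangular {c ℓ} (F : CommutativeRing c ℓ) (s n : ℕ) where
  open CyclicOrder n
  open Construction F s D
  open Matrices F s D
  open TruncatedPolynomials F s D using (Rˢ; *R-cong; *R-zeroˡ; *R-zeroʳ; *R-identityˡ; *R-identityʳ)
  open Semiring Rˢ using (+-commutativeMonoid) renaming (refl to ≈R-refl; sym to ≈R-sym;
    trans to ≈R-trans; +-cong to +R-cong; +-comm to +R-comm)
  open Monoid Matˢ using (identityˡ; identityʳ; ∙-congˡ; ∙-congʳ) renaming (sym to ≈M-sym; trans to ≈M-trans)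
  open import Algebra.Properties.Monoid Matˢ using (cancelˡ; cancelᶜ)
  open FiniteSums +-commutativeMonoid
  module F = CommutativeRing F
  open import Algebra.Properties.Group F.+-group using (\\-leftDividesˡ)
  open import Relation.Binary.Reasoning.Setoid (Semiring.setoid Rˢ)

  Linear : R → Set (c ⊔ ℓ)
  Linear r = ∃₂ λ a b → r ≈R lin a b

  lin-cong : ∀ {a a′ b b′} → a F.≈ a′ → b F.≈ b′ → lin a b ≈R lin a′ b′
  lin-cong a≈a′ b≈b′ k with toℕ k
  ... | zero        = b≈b′
  ... | suc zero    = a≈a′
  ... | suc (suc _) = F.refl

  lin-+ : ∀ a b a′ b′ → (lin a b +R lin a′ b′) ≈R lin (a F.+ a′) (b F.+ b′)
  lin-+ a b a′ b′ k with toℕ k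
  ... | zero        = F.refl
  ... | suc zero    = F.refl
  ... | suc (suc _) = F.+-identityˡ F.0#

  lin-zero : lin F.0# F.0# ≈R 0R
  lin-zero k with toℕ k
  ... | zero        = F.refl
  ... | suc zero    = F.refl
  ... | suc (suc _) = F.refl

  Linear-zero : ∀ {r} → r ≈R 0R → Linear r
  Linear-zero r≈0 = F.0# , F.0# , ≈R-trans r≈0 (≈R-sym lin-zero)

  Linear-resp : ∀ {r r′} → r ≈R r′ → Linear r → Linear r′
  Linear-resp r≈r′ (a , b , r≈lin) = a , b , ≈R-trans (≈R-sym r≈r′) r≈lin

  Linear-+ : ∀ {r r′} → Linear r → Linear r′ → Linear (r +R r′)
  Linear-+ (a , b , r≈) (a′ , b′ , r′≈) = a F.+ a′ , b F.+ b′ , ≈R-trans (+R-cong r≈ r′≈) (lin-+ a b a′ b′)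

  linear-gap : ∀ {r r′} → Linear r → Linear r′ → Σ R λ γ → Linear γ × (r +R γ) ≈R r′
  linear-gap {r} {r′} (a , b , r≈) (a′ , b′ , r′≈) =
    γ , (F.- a F.+ a′ , F.- b F.+ b′ , ≈R-refl) ,
    ≈R-trans (+R-cong r≈ (≈R-refl {γ})) (≈R-trans (lin-+ a b _ _)
      (≈R-trans (lin-cong (\\-leftDividesˡ a a′) (\\-leftDividesˡ b b′)) (≈R-sym r′≈)))
    where
    γ : R
    γ = lin (F.- a F.+ a′) (F.- b F.+ b′)

  record U (l : Fin D) (A : Mat) : Set (c ⊔ ℓ) where
    field
      diag  : ∀ a → A a a ≈R 1R
      lower : ∀ a b → a ≢ b → ¬ (pos l a < pos l b) → A a b ≈R 0R
      super : ∀ a → a ≢ l → Linear (A a (nextMod a))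
  open U public

  U-resp : ∀ {l A B} → U l A → A ≈M B → U l B
  U-resp u A≈B = record
    { diag  = λ a → ≈R-trans (≈R-sym (A≈B a a)) (diag u a)
    ; lower = λ a b a≢b ≮ → ≈R-trans (≈R-sym (A≈B a b)) (lower u a b a≢b ≮)
    ; super = λ a a≢l → Linear-resp (A≈B a (nextMod a)) (super u a a≢l)
    }

  U-1M : ∀ l → U l 1M
  U-1M l = record
    { diag  = 1M-diag
    ; lower = λ a b a≢b _ → 1M-off a b a≢b
    ; super = λ a a≢l → Linear-zero (1M-off a (nextMod a) (nextMod-moves a≢l ∘ ≡.sym))
    }

  U-gen : ∀ l m r → m ≢ l → Linear r → U l (e m (nextMod m) r)
  U-gen l m r m≢l lin-r = record
    { diag  = e-diag m (nextMod m) r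
    ; lower = λ a b a≢b ≮ → e-miss m (nextMod m) r a b a≢b
        λ { (≡.refl , ≡.refl) → ≮ (≡.subst (pos l a <_) (≡.sym (pos-next l a m≢l)) (ℕₚ.n<1+n _)) }
    ; super = super-gen
    }
    where
    super-gen : ∀ a → a ≢ l → Linear (e m (nextMod m) r a (nextMod a))
    super-gen a a≢l = by-cases (a ≟ m)
      where
      -- (a matching on a ≟ m directly would also abstract it inside e)
      by-cases : Dec (a ≡ m) → Linear (e m (nextMod m) r a (nextMod a))
      by-cases (yes a≡m) = ≡.subst (λ x → Linear (e m (nextMod m) r x (nextMod x))) (≡.sym a≡m)
                             (Linear-resp (≈R-sym (e-hit m (nextMod m) r (nextMod-moves m≢l ∘ ≡.sym))) lin-r)
      by-cases (no a≢m)  = Linear-zero (e-miss m (nextMod m) r a (nextMod a) (nextMod-moves a≢l ∘ ≡.sym) (a≢m ∘ proj₁))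

  module _ {l A B} (uA : U l A) (uB : U l B) where
    private
      term-left : ∀ a b k → k ≢ a → ¬ (pos l a < pos l k) → (A a k *R B k b) ≈R 0R
      term-left a b k k≢a ≮ = ≈R-trans (*R-cong (lower uA a k (k≢a ∘ ≡.sym) ≮) ≈R-refl) (*R-zeroˡ _)

      term-right : ∀ a b k → k ≢ b → ¬ (pos l k < pos l b) → (A a k *R B k b) ≈R 0R
      term-right a b k k≢b ≮ = ≈R-trans (*R-cong ≈R-refl (lower uB k b k≢b ≮)) (*R-zeroʳ _)

    U-mul-lower : ∀ a b → a ≢ b → ¬ (pos l a < pos l b) → (A *M B) a b ≈R 0R
    U-mul-lower a b a≢b a≮b = ≈R-trans (*M-entry A B a b) (sum-zero _ term)
      where
      term : ∀ k → (A a k *R B k b) ≈R 0R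
      term k with k ≟ a | pos l a ℕ.<? pos l k | k ≟ b | pos l k ℕ.<? pos l b
      ... | yes ≡.refl | _       | _          | _       = term-right a b k a≢b a≮b
      ... | no k≢a     | no a≮k  | _          | _       = term-left a b k k≢a a≮k
      ... | no _       | yes a<k | yes ≡.refl | _       = ⊥-elim (a≮b a<k)
      ... | no _       | yes a<k | no _       | yes k<b = ⊥-elim (a≮b (ℕₚ.<-trans a<k k<b))
      ... | no _       | yes _   | no k≢b     | no k≮b = term-right a b k k≢b k≮b

    U-mul-diag : ∀ a → (A *M B) a a ≈R 1R
    U-mul-diag a = ≈R-trans (*M-entry A B a a) (≈R-trans (sum-single _ a term)
      (≈R-trans (*R-cong (diag uA a) (diag uB a)) (*R-identityˡ _)))
      where
      term : ∀ k → k ≢ a → (A a k *R B k a) ≈R 0R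
      term k k≢a with pos l a ℕ.<? pos l k
      ... | no  a≮k = term-left a a k k≢a a≮k
      ... | yes a<k = term-right a a k k≢a (ℕₚ.<⇒≯ a<k)

    U-mul-super : ∀ a → a ≢ l → (A *M B) a (nextMod a) ≈R (A a (nextMod a) +R B a (nextMod a))
    U-mul-super a a≢l = begin
      (A *M B) a a′                             ≈⟨ *M-entry A B a a′ ⟩
      ∑[ k < D ] (A a k *R B k a′)              ≈⟨ sum-pair _ (a′≢a ∘ ≡.sym) term ⟩
      (A a a *R B a a′) +R (A a a′ *R B a′ a′)
        ≈⟨ +R-cong (≈R-trans (*R-cong (diag uA a) ≈R-refl) (*R-identityˡ _))
                   (≈R-trans (*R-cong ≈R-refl (diag uB a′)) (*R-identityʳ _)) ⟩
      B a a′ +R A a a′                          ≈⟨ +R-comm _ _ ⟩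
      A a a′ +R B a a′                          ∎
      where
      a′ : Fin D
      a′ = nextMod a
      a′≢a : a′ ≢ a
      a′≢a = nextMod-moves a≢l
      term : ∀ k → k ≢ a → k ≢ a′ → (A a k *R B k a′) ≈R 0R
      term k k≢a k≢a′ with pos l a ℕ.<? pos l k
      ... | no  a≮k = term-left a a′ k k≢a a≮k
      ... | yes a<k = term-right a a′ k k≢a′ λ k<a′ →
        ℕₚ.<-irrefl ≡.refl (ℕₚ.<-≤-trans a<k (ℕₚ.≤-pred (≡.subst (pos l k <_) (pos-next l a a≢l) k<a′)))

    U-mul : U l (A *M B)
    U-mul = record
      { diag  = U-mul-diag
      ; lower = U-mul-lower
      ; super = λ a a≢l → Linear-resp (≈R-sym (U-mul-super a a≢l)) (Linear-+ (super uA a a≢l) (super uB a a≢l))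
      }

  Shaped : (Fin D → Set) → Mat → Set (c ⊔ ℓ)
  Shaped S x = ∀ l → ¬ S l → U l x

  Shaped-mul : ∀ {S x y} → Shaped S x → Shaped S y → Shaped S (x *M y)
  Shaped-mul shx shy l l∉S = U-mul (shx l l∉S) (shy l l∉S)

  -- Off the diagonal, an S-shaped
  -- matrix can only be nonzero at the positions (a, a+1) with a ∈ S: for a ∉ S
  -- use U a (row a is last), for a ∈ S use U (a+1) (row a is next to last).
  shaped-off : ∀ {S : Fin D → Set} → Decidable S → ∀ {x} → Shaped S x →
    ∀ a b → a ≢ b → ¬ (S a × b ≡ nextMod a) → ¬ (S a × S (nextMod a)) → x a b ≈R 0R
  shaped-off {S} S? shx a b a≢b not-super not-consecutive with S? a
  ... | no a∉S = lower (shx a a∉S) a b a≢b λ a<b → ℕₚ.<⇒≱ a<b (pos≤last a b)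
  ... | yes a∈S = lower (shx a′ a′∉S) a b a≢b λ a<b →
    ℕₚ.<-irrefl ≡.refl (ℕₚ.<-≤-trans a<b (ℕₚ.≤-pred b<a′))
    where
    a′ : Fin D
    a′ = nextMod a
    a′∉S : ¬ S a′
    a′∉S a′∈S = not-consecutive (a∈S , a′∈S)
    a≢a′ : a ≢ a′
    a≢a′ a≡a′ = a′∉S (≡.subst S a≡a′ a∈S)
    -- b precedes a′, which directly follows a, in the order after a′
    b<a′ : pos a′ b < suc (pos a′ a)
    b<a′ = ≡.subst (pos a′ b <_) (pos-next a′ a a≢a′)
      (ℕₚ.≤∧≢⇒< (pos≤last a′ b) (λ b≡a′ → not-super (a∈S , pos-injective a′ b≡a′)))

  -- An S-shaped matrix is determined by its entries (a, a+1), a ∈ S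
  -- (the diagonal is 1 by membership in any U l with l ∉ S).
  shaped-ext : ∀ {S : Fin D → Set} → Decidable S → (∀ a → ¬ (S a × S (nextMod a))) →
    ∀ l → ¬ S l → ∀ {x y} → Shaped S x → Shaped S y →
    (∀ a → S a → x a (nextMod a) ≈R y a (nextMod a)) → x ≈M y
  shaped-ext {S} S? not-consecutive l l∉S {x} {y} shx shy super-eq a b with a ≟ b
  ... | yes ≡.refl = ≈R-trans (diag (shx l l∉S) a) (≈R-sym (diag (shy l l∉S) a))
  ... | no a≢b with S? a ×-dec (b ≟ nextMod a)
  ...   | yes (a∈S , ≡.refl) = super-eq a a∈S
  ...   | no not-super = ≈R-trans (shaped-off S? shx a b a≢b not-super (not-consecutive a))
                                  (≈R-sym (shaped-off S? shy a b a≢b not-super (not-consecutive a)))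

  -- e_{m,m+1}(r) e_{m,m+1}(r′) = 1 when r + r′ = 0: both sides are {m}-shaped
  -- and agree at the single entry (m, m+1).
  e-inverse : ∀ l m {r r′} → m ≢ l → Linear r → Linear r′ → (r +R r′) ≈R 0R →
              (e m (nextMod m) r *M e m (nextMod m) r′) ≈M 1M
  e-inverse l m {r} {r′} m≢l lin-r lin-r′ r+r′≈0 =
    shaped-ext (_≟ m) not-consecutive l (m≢l ∘ ≡.sym)
      (Shaped-mul (gen-shaped lin-r) (gen-shaped lin-r′)) (λ l′ _ → U-1M l′) super-eq
    where
    m′≢m : nextMod m ≢ m
    m′≢m = nextMod-moves m≢l
    not-consecutive : ∀ a → ¬ (a ≡ m × nextMod a ≡ m)
    not-consecutive a (≡.refl , m′≡m) = m′≢m m′≡m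
    gen-shaped : ∀ {r} → Linear r → Shaped (_≡ m) (e m (nextMod m) r)
    gen-shaped lin l′ l′≢m = U-gen l′ m _ (l′≢m ∘ ≡.sym) lin
    super-eq : ∀ a → a ≡ m → (e m (nextMod m) r *M e m (nextMod m) r′) a (nextMod a) ≈R 1M a (nextMod a)
    super-eq a ≡.refl = begin
      (e a (nextMod a) r *M e a (nextMod a) r′) a (nextMod a)
        ≈⟨ U-mul-super (U-gen l a r m≢l lin-r) (U-gen l a r′ m≢l lin-r′) a m≢l ⟩
      e a (nextMod a) r a (nextMod a) +R e a (nextMod a) r′ a (nextMod a)
        ≈⟨ +R-cong (e-hit a (nextMod a) r (m′≢m ∘ ≡.sym)) (e-hit a (nextMod a) r′ (m′≢m ∘ ≡.sym)) ⟩
      r +R r′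
        ≈⟨ r+r′≈0 ⟩
      0R
        ≈⟨ 1M-off a (nextMod a) (m′≢m ∘ ≡.sym) ⟨
      1M a (nextMod a) ∎

  -- The invariant that makes K l ⊆ U l provable by induction: g lies in U l
  -- and has a two-sided inverse in U l (needed for the `inv` constructor).
  record UnitOf (l : Fin D) (g : Mat) : Set (c ⊔ ℓ) where
    field
      member         : U l g
      inverse        : Mat
      inverse-member : U l inverse
      right-inverse  : (g *M inverse) ≈M 1M
      left-inverse   : (inverse *M g) ≈M 1M

  -- Induction over the generation of K l: generators are inverted by generators,
  -- products by reversed products, and the `inv` constructor yields the inverse.
  K⇒UnitOf : ∀ {l g} → K l g → UnitOf l g
  K⇒UnitOf {l} (⟨_⟩.gen (m , x , y , m≢l , g≈e)) = record
    { member         = U-resp (U-gen l m r m≢l lin-r) (≈M-sym g≈e)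
    ; inverse        = e m (nextMod m) γ
    ; inverse-member = U-gen l m γ m≢l lin-γ
    ; right-inverse  = ≈M-trans (∙-congʳ {e m (nextMod m) γ} g≈e) (e-inverse l m m≢l lin-r lin-γ r+γ≈0)
    ; left-inverse   = ≈M-trans (∙-congˡ {e m (nextMod m) γ} g≈e) (e-inverse l m m≢l lin-γ lin-r (≈R-trans (+R-comm γ r) r+γ≈0))
    }
    where
    r : R
    r = lin x y
    lin-r : Linear r
    lin-r = x , y , ≈R-refl
    gap = linear-gap lin-r (Linear-zero (≈R-refl {0R}))
    γ : R
    γ = proj₁ gap
    lin-γ : Linear γ
    lin-γ = proj₁ (proj₂ gap)
    r+γ≈0 : (r +R γ) ≈R 0R
    r+γ≈0 = proj₂ (proj₂ gap)
  K⇒UnitOf {l} ⟨_⟩.one = record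
    { member = U-1M l ; inverse = 1M ; inverse-member = U-1M l
    ; right-inverse = identityˡ 1M ; left-inverse = identityˡ 1M }
  K⇒UnitOf {l} (⟨_⟩.mul {g} {h} kg kh) = record
    { member         = U-mul (member ug) (member uh)
    ; inverse        = inverse uh *M inverse ug
    ; inverse-member = U-mul (inverse-member uh) (inverse-member ug)
    ; right-inverse  = ≈M-trans (cancelᶜ {a = h} {c = inverse uh} (right-inverse uh) g (inverse ug)) (right-inverse ug)
    ; left-inverse   = ≈M-trans (cancelᶜ {a = inverse ug} {c = g} (left-inverse ug) (inverse uh) h) (left-inverse uh)
    }
    where
    open UnitOf
    ug = K⇒UnitOf kg
    uh = K⇒UnitOf kh
  K⇒UnitOf {l} (⟨_⟩.inv {g} {h} kg gh≈1) = record
    { member         = U-resp (inverse-member ug) g⁻¹≈h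
    ; inverse        = g
    ; inverse-member = member ug
    ; right-inverse  = ≈M-trans (∙-congʳ {g} (≈M-sym g⁻¹≈h)) (left-inverse ug)
    ; left-inverse   = gh≈1
    }
    where
    open UnitOf
    ug = K⇒UnitOf kg
    -- h = g⁻¹ (g h) = g⁻¹
    g⁻¹≈h : inverse ug ≈M h
    g⁻¹≈h = ≈M-trans (≈M-sym (identityʳ _)) (≈M-trans (∙-congˡ {inverse ug} (≈M-sym gh≈1)) (cancelˡ {a = inverse ug} {c = g} (left-inverse ug) h))
  K⇒UnitOf {l} (⟨_⟩.resp {g} {h} kg g≈h) = record
    { member         = U-resp (member ug) g≈h
    ; inverse        = inverse ug
    ; inverse-member = inverse-member ug
    ; right-inverse  = ≈M-trans (∙-congʳ {inverse ug} (≈M-sym g≈h)) (right-inverse ug)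
    ; left-inverse   = ≈M-trans (∙-congˡ {inverse ug} (≈M-sym g≈h)) (left-inverse ug)
    }
    where
    open UnitOf
    ug = K⇒UnitOf kg

  K⊆U : ∀ {l g} → K l g → U l g
  K⊆U = UnitOf.member ∘ K⇒UnitOf

module _ {a r} {A : Set a} {R : A → A → Set r} where
  AllPairs-++-across : ∀ xs {ys} → AllPairs R (xs ++ ys) → All (λ x → All (R x) ys) xs
  AllPairs-++-across []       _          = []
  AllPairs-++-across (x ∷ xs) (Rx ∷ Rxs) = All.++⁻ʳ xs Rx ∷ AllPairs-++-across xs Rxs

  AllPairs-++⁻ʳ : ∀ xs {ys} → AllPairs R (xs ++ ys) → AllPairs R ys
  AllPairs-++⁻ʳ []       Rys       = Rys
  AllPairs-++⁻ʳ (x ∷ xs) (_ ∷ Rxs) = AllPairs-++⁻ʳ xs Rxs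

module Link {c ℓ} (F : CommutativeRing c ℓ) (s n : ℕ) (i j : Fin (suc n))
            (i≢j : i ≢ j) (j≢i′ : j ≢ nextMod i) (i≢j′ : i ≢ nextMod j) where
  open CyclicOrder n
  open Construction F s D
  open Matrices F s D
  open Unitriangular F s n
  open TruncatedPolynomials F s D using (Rˢ)
  open Semiring Rˢ using () renaming (refl to ≈R-refl; trans to ≈R-trans;
    +-cong to +R-cong; +-identityʳ to +R-identityʳ)
  open Monoid Matˢ using (identityˡ; assoc; ∙-congʳ) renaming (refl to ≈M-refl; sym to ≈M-sym; trans to ≈M-trans)
  open import Relation.Binary.Reasoning.Setoid (Semiring.setoid Rˢ)

  InS : Fin D → Set
  InS a = a ≡ i ⊎ a ≡ j

  InS? : Decidable InS
  InS? a = (a ≟ i) ⊎-dec (a ≟ j)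

  i∈S : InS i
  i∈S = inj₁ ≡.refl

  j∈S : InS j
  j∈S = inj₂ ≡.refl

  i′ j′ : Fin D
  i′ = nextMod i
  j′ = nextMod j

  i′≢i : i′ ≢ i
  i′≢i = nextMod-moves i≢j

  j′≢j : j′ ≢ j
  j′≢j = nextMod-moves (i≢j ∘ ≡.sym)

  i′∉S : ¬ InS i′
  i′∉S = [ i′≢i , j≢i′ ∘ ≡.sym ]

  j′∉S : ¬ InS j′
  j′∉S = [ i≢j′ ∘ ≡.sym , j′≢j ]

  not-consecutive : ∀ a → ¬ (InS a × InS (nextMod a))
  not-consecutive a (inj₁ ≡.refl , a′∈S) = i′∉S a′∈S
  not-consecutive a (inj₂ ≡.refl , a′∈S) = j′∉S a′∈S

  v : List TC
  v = vFace i j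

  outside? : ∀ l → Dec (¬ l ≡ i × ¬ l ≡ j)
  outside? l = ¬? (l ≟ i) ×-dec ¬? (l ≟ j)

  All-v : ∀ {p} {Q : TC → Set p} → (∀ l → ¬ InS l → Q (l , 1M)) → All Q v
  All-v Q-out = All.map⁺ (All.map (λ { {l} (l≢i , l≢j) → Q-out l [ l≢i , l≢j ] })
                                  (All.all-filter outside? (allFin D)))

  lookup-v : ∀ {p} {Q : TC → Set p} → All Q v → ∀ l → ¬ InS l → Q (l , 1M)
  lookup-v Qv l l∉S = lookupAll Qv (∈-map⁺ (λ l → (l , 1M)) (∈-filter⁺ outside? (∈-allFin l) (l∉S ∘ inj₁ , l∉S ∘ inj₂)))

  v-types-distinct : AllPairs _≢_ (map type v)
  v-types-distinct = AP.map⁺ (AP.map⁺ (AP.filter⁺ outside? (AP.tabulate⁺ id)))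

  Core : Mat → Set (c ⊔ ℓ)
  Core x = ∀ l → ¬ InS l → K l x

  on-v⇒Core : ∀ {x} → All (x ∈C_) v → Core x
  on-v⇒Core x-on-v l l∉S with lookup-v x-on-v l l∉S
  ... | k , k∈K , 1k≈x = ⟨_⟩.resp k∈K (≈M-trans (≈M-sym (identityˡ k)) 1k≈x)

  Core⇒on-v : ∀ {x} → Core x → All (x ∈C_) v
  Core⇒on-v {x} core = All-v (λ l l∉S → x , core l l∉S , identityˡ x)

  Core⇒Shaped : ∀ {x} → Core x → Shaped InS x
  Core⇒Shaped core l l∉S = K⊆U (core l l∉S)

  gen-K : ∀ {l} m γ → m ≢ l → Linear γ → K l (e m (nextMod m) γ)
  gen-K m γ m≢l (a , b , γ≈lin) = ⟨_⟩.gen (m , a , b , m≢l , e-cong m (nextMod m) γ≈lin)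

  a′∉S : ∀ {a} → InS a → ¬ InS (nextMod a)
  a′∉S {a} a∈S a′∈S = not-consecutive a (a∈S , a′∈S)

  a≢a′ : ∀ {a} → InS a → a ≢ nextMod a
  a≢a′ a∈S a≡a′ = a′∉S a∈S (≡.subst InS a≡a′ a∈S)

  shaped-super : ∀ {x} → Shaped InS x → ∀ {a} → InS a → Linear (x a (nextMod a))
  shaped-super shx {a} a∈S = super (shx (nextMod a) (a′∉S a∈S)) a (a≢a′ a∈S)

  shaped-gen : ∀ {b} γ → InS b → Linear γ → Shaped InS (e b (nextMod b) γ)
  shaped-gen {b} γ b∈S lin-γ l l∉S = U-gen l b γ (λ b≡l → l∉S (≡.subst InS b≡l b∈S)) lin-γ

  module _ {x} (shx : Shaped InS x) {a} (a∈S : InS a) {γ} (lin-γ : Linear γ) where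
    private
      a′ = nextMod a
      correction : ∀ {b} → InS b → (x *M e b (nextMod b) γ) a a′ ≈R (x a a′ +R e b (nextMod b) γ a a′)
      correction b∈S = U-mul-super (shx a′ (a′∉S a∈S)) (shaped-gen γ b∈S lin-γ a′ (a′∉S a∈S)) a (a≢a′ a∈S)

    correction-same : (x *M e a a′ γ) a a′ ≈R (x a a′ +R γ)
    correction-same = ≈R-trans (correction a∈S) (+R-cong ≈R-refl (e-hit a a′ γ (a≢a′ a∈S)))

    correction-other : ∀ {b} → InS b → a ≢ b → (x *M e b (nextMod b) γ) a a′ ≈R x a a′
    correction-other b∈S a≢b = ≈R-trans (correction b∈S)
      (≈R-trans (+R-cong ≈R-refl (e-miss _ _ γ a a′ (a≢a′ a∈S) (a≢b ∘ proj₁))) (+R-identityʳ _))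

  -- Step (3): any two points x₁, x₂ of the core have a common point y of x₁K_i and
  -- x₂K_j in the core, y = x₁ e_{j,j+1}(γ) = x₂ e_{i,i+1}(δ), where γ and δ are
  -- chosen so that both products agree at (i, i+1) and (j, j+1).
  common-point : ∀ {x₁ x₂} → Core x₁ → Core x₂ →
                 Σ Mat λ y → y ∈C (i , x₁) × y ∈C (j , x₂) × Core y
  common-point {x₁} {x₂} core₁ core₂ =
    x₁ *M Eⱼ , (Eⱼ , gen-K j γ (i≢j ∘ ≡.sym) lin-γ , ≈M-refl) ,
    (Eᵢ , gen-K i δ i≢j lin-δ , products-agree) ,
    (λ l l∉S → ⟨_⟩.mul (core₁ l l∉S) (gen-K j γ (l∉S ∘ inj₂ ∘ ≡.sym) lin-γ))
    where
    sh₁ = Core⇒Shaped core₁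
    sh₂ = Core⇒Shaped core₂
    -- x₁ j j′ + γ = x₂ j j′ and x₂ i i′ + δ = x₁ i i′
    gap-j = linear-gap (shaped-super sh₁ j∈S) (shaped-super sh₂ j∈S)
    gap-i = linear-gap (shaped-super sh₂ i∈S) (shaped-super sh₁ i∈S)
    γ δ : R
    γ = proj₁ gap-j
    δ = proj₁ gap-i
    lin-γ : Linear γ
    lin-γ = proj₁ (proj₂ gap-j)
    lin-δ : Linear δ
    lin-δ = proj₁ (proj₂ gap-i)
    Eⱼ Eᵢ : Mat
    Eⱼ = e j j′ γ
    Eᵢ = e i i′ δ
    agree : ∀ a → InS a → (x₂ *M Eᵢ) a (nextMod a) ≈R (x₁ *M Eⱼ) a (nextMod a)
    agree a (inj₁ ≡.refl) = begin
      (x₂ *M Eᵢ) i i′ ≈⟨ correction-same sh₂ i∈S lin-δ ⟩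
      x₂ i i′ +R δ    ≈⟨ proj₂ (proj₂ gap-i) ⟩
      x₁ i i′         ≈⟨ correction-other sh₁ i∈S lin-γ j∈S i≢j ⟨
      (x₁ *M Eⱼ) i i′ ∎
    agree a (inj₂ ≡.refl) = begin
      (x₂ *M Eᵢ) j j′ ≈⟨ correction-other sh₂ j∈S lin-δ i∈S (i≢j ∘ ≡.sym) ⟩
      x₂ j j′         ≈⟨ proj₂ (proj₂ gap-j) ⟨
      x₁ j j′ +R γ    ≈⟨ correction-same sh₁ j∈S lin-γ ⟨
      (x₁ *M Eⱼ) j j′ ∎
    products-agree : (x₂ *M Eᵢ) ≈M (x₁ *M Eⱼ)
    products-agree = shaped-ext InS? not-consecutive i′ i′∉S
      (Shaped-mul sh₂ (shaped-gen δ i∈S lin-δ)) (Shaped-mul sh₁ (shaped-gen γ j∈S lin-γ)) agree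

  ∈C-trans : ∀ {t g x y} → x ∈C (t , g) → y ∈C (t , x) → y ∈C (t , g)
  ∈C-trans {g = g} (k , k∈K , gk≈x) (k′ , k′∈K , xk′≈y) =
    k *M k′ , ⟨_⟩.mul k∈K k′∈K , ≈M-trans (≈M-sym (assoc g k k′)) (≈M-trans (∙-congʳ {k′} gk≈x) xk′≈y)

  ∈C-G : ∀ {t g y} → G g → y ∈C (t , g) → G y
  ∈C-G {t} G-g (k , k∈K , gk≈y) = ⟨_⟩.resp (⟨_⟩.mul G-g (⟨_⟩.gen (t , k∈K))) gk≈y

  -- Every vertex of the link has type i or j: its type differs from those of v.
  vertex-type : ∀ w → LinkVertex i j w → InS (type w)
  vertex-type w (_ , _ , _ , distinct , _) with InS? (type w)
  ... | yes w∈S = w∈S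
  ... | no  w∉S = ⊥-elim (lookupAll (lookup-v (All.map⁻ types-across) (type w) w∉S) (here ≡.refl) ≡.refl)
    where
    types-across : All (λ t → All (t ≢_) (type w ∷ [])) (map type v)
    types-across = AllPairs-++-across (map type v) (≡.subst (AllPairs _≢_) (map-++ type v (w ∷ [])) distinct)

  vertex-point : ∀ w → LinkVertex i j w → Σ Mat λ x → x ∈C w × Core x
  vertex-point w (_ , _ , _ , _ , x , _ , x-on) =
    x , lookupAll (All.++⁻ʳ v x-on) (here ≡.refl) , on-v⇒Core (All.++⁻ˡ v x-on)

  face-extending-v : ∀ ws → All (λ w → G (rep w)) ws → All (λ w → InS (type w)) ws →
    AllPairs _≢_ (map type ws) → ∀ y → G y → All (y ∈C_) ws → Core y → IsFace (v ++ ws)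
  face-extending-v ws G-ws ws⊆S ws-distinct y G-y y∈ws core-y =
    All.++⁺ (All-v (λ _ _ → ⟨_⟩.one)) G-ws ,
    ≡.subst (AllPairs _≢_) (≡.sym (map-++ type v ws))
      (AP.++⁺ v-types-distinct ws-distinct
        (All.map⁺ (All-v (λ l l∉S → All.map⁺ (All.map (λ t∈S l≡t → l∉S (≡.subst InS (≡.sym l≡t) t∈S)) ws⊆S))))) ,
    y , G-y , All.++⁺ (Core⇒on-v core-y) y∈ws

  base-vertex : ∀ t → InS t → LinkVertex i j (t , 1M)
  base-vertex t t∈S =
    ⟨_⟩.one , not-in-v ,
    face-extending-v ((t , 1M) ∷ []) (⟨_⟩.one ∷ []) (t∈S ∷ []) ([] ∷ [])
      1M ⟨_⟩.one ((1M , ⟨_⟩.one , identityˡ 1M) ∷ []) (λ _ _ → ⟨_⟩.one)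
    where
    not-in-v : ¬ Any ((t , 1M) ≐_) v
    not-in-v = All.All¬⇒¬Any (All-v (λ l l∉S (t≡l , _) → l∉S (≡.subst InS t≡l t∈S)))

  edge : ∀ {w₁ w₂} (lv₁ : LinkVertex i j w₁) (lv₂ : LinkVertex i j w₂) → type w₁ ≡ i → type w₂ ≡ j →
         LinkE i j (w₁ , lv₁) (w₂ , lv₂) × LinkE i j (w₂ , lv₂) (w₁ , lv₁)
  edge {i , g} {j , h} lv₁ lv₂ ≡.refl ≡.refl =
    ((i≢j ∘ proj₁) ,
      face-extending-v _ (proj₁ lv₁ ∷ proj₁ lv₂ ∷ []) (i∈S ∷ j∈S ∷ []) ((i≢j ∷ []) ∷ [] ∷ [])
        y G-y (y∈w₁ ∷ y∈w₂ ∷ []) core-y) ,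
    ((i≢j ∘ ≡.sym ∘ proj₁) ,
      face-extending-v _ (proj₁ lv₂ ∷ proj₁ lv₁ ∷ []) (j∈S ∷ i∈S ∷ []) (((i≢j ∘ ≡.sym) ∷ []) ∷ [] ∷ [])
        y G-y (y∈w₂ ∷ y∈w₁ ∷ []) core-y)
    where
    p₁ = vertex-point (i , g) lv₁
    p₂ = vertex-point (j , h) lv₂
    common = common-point (proj₂ (proj₂ p₁)) (proj₂ (proj₂ p₂))
    y : Mat
    y = proj₁ common
    y∈w₁ : y ∈C (i , g)
    y∈w₁ = ∈C-trans {g = g} (proj₁ (proj₂ p₁)) (proj₁ (proj₂ common))
    y∈w₂ : y ∈C (j , h)
    y∈w₂ = ∈C-trans {g = h} (proj₁ (proj₂ p₂)) (proj₁ (proj₂ (proj₂ common)))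
    core-y : Core y
    core-y = proj₂ (proj₂ (proj₂ common))
    G-y : G y
    G-y = ∈C-G (proj₁ lv₁) y∈w₁

  edge⇒types-differ : ∀ u w → LinkE i j u w → type (proj₁ u) ≢ type (proj₁ w)
  edge⇒types-differ (w₁ , _) (w₂ , _) (_ , _ , distinct , _)
    with AllPairs-++⁻ʳ (map type v) (≡.subst (AllPairs _≢_) (map-++ type v (w₁ ∷ w₂ ∷ [])) distinct)
  ... | (t₁≢t₂ ∷ []) ∷ _ = t₁≢t₂

  side : LinkV i j → Bool
  side ((t , _) , _) = does (t ≟ i)

  side-i : does (i ≟ i) ≡ true
  side-i = dec-true (i ≟ i) ≡.refl

  side-j : does (j ≟ i) ≡ false
  side-j = dec-false (j ≟ i) (i≢j ∘ ≡.sym)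

  same-side⇒same-type : ∀ {t₁ t₂} → InS t₁ → InS t₂ → does (t₁ ≟ i) ≡ does (t₂ ≟ i) → t₁ ≡ t₂
  same-side⇒same-type (inj₁ e₁) (inj₁ e₂) _ = ≡.trans e₁ (≡.sym e₂)
  same-side⇒same-type (inj₂ e₁) (inj₂ e₂) _ = ≡.trans e₁ (≡.sym e₂)
  same-side⇒same-type (inj₁ ≡.refl) (inj₂ ≡.refl) same with ≡.trans (≡.sym side-i) (≡.trans same side-j)
  ... | ()
  same-side⇒same-type (inj₂ ≡.refl) (inj₁ ≡.refl) same with ≡.trans (≡.sym side-i) (≡.trans (≡.sym same) side-j)
  ... | ()

  edge⇔opposite-sides : ∀ u w → LinkE i j u w ⇔ (side u ≢ side w)
  edge⇔opposite-sides u@((t₁ , _) , lv₁) w@((t₂ , _) , lv₂) = mk⇔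
    (λ uw same → edge⇒types-differ u w uw (same-side⇒same-type (vertex-type _ lv₁) (vertex-type _ lv₂) same))
    (opposite (vertex-type _ lv₁) (vertex-type _ lv₂))
    where
    opposite : InS t₁ → InS t₂ → side u ≢ side w → LinkE i j u w
    opposite (inj₁ e₁) (inj₂ e₂) _  = proj₁ (edge lv₁ lv₂ e₁ e₂)
    opposite (inj₂ e₁) (inj₁ e₂) _  = proj₂ (edge lv₂ lv₁ e₂ e₁)
    opposite (inj₁ e₁) (inj₁ e₂) ≢s = ⊥-elim (≢s (cong (λ t → does (t ≟ i)) (≡.trans e₁ (≡.sym e₂))))
    opposite (inj₂ e₁) (inj₂ e₂) ≢s = ⊥-elim (≢s (cong (λ t → does (t ≟ i)) (≡.trans e₁ (≡.sym e₂))))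

  link-complete-bipartite : IsCompleteBipartite (LinkV i j) (LinkE i j)
  link-complete-bipartite =
    side ,
    (((i , 1M) , base-vertex i i∈S) , side-i) ,
    (((j , 1M) , base-vertex j j∈S) , side-j) ,
    edge⇔opposite-sides

-- The link of v is complete bipartite; d = 0 cannot occur since Fin 0 is empty.
mainTheorem7 : ∀ {c ℓ} (F : CommutativeRing c ℓ) → IsField F →
    (p : ℕ) → IsPrimePower p → HasSize F p →
    (s d : ℕ) → 1 ≤ s → 3 ≤ d →
    (i j : Fin d) → i ≢ j → j ≢ nextMod i → i ≢ nextMod j →
    IsCompleteBipartite (Construction.LinkV F s d i j)
    (Construction.LinkE F s d i j)
mainTheorem7 F _ _ _ _ s (suc n) _ _ i j i≢j j≢i′ i≢j′ =
  Link.link-complete-bipartite F s n i j i≢j j≢i′ i≢j′
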